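{- Consider the game ${\rm SCN}(4,2)$ (Shrinking Circular Nim with initial number of piles $n=4$ and $k=2$). Its P-positions (among all configurations that can arise, i.e. circular arrangements of at most $4$ piles, each pile containing a positive integer number of stones) are exactly: the terminal configuration $()$; the configurations $(a,a,a)$ with $a\ge 1$; and the configurations $(a,b,a,b)$ with $a,b\ge 1$ and $a\neq b$.
   Context: Shrinking Circular Nim ${\rm SCN}(n,k)$, for positive integers $k\le n$: initially $n$ piles of stones are arranged on a circle. Two players alternate turns. On a turn, a player selects $k$ consecutive (cyclically adjacent) piles among the currently remaining piles and removes any number of stones from each of them, removing at least one stone in total (some of the selected piles may be left untouched). Whenever a pile becomes empty it vanishes and the circle closes up: the remaining piles keep their cyclic order and the neighbours of the vanished pile become adjacent. If at most $k$ piles remain, a move may remove stones from any of the remaining piles (all of them may be selected). The player who removes the last stone wins (a player with no move loses). A configuration is written as the tuple $(x_1,\dots,x_r)$ of the positive pile sizes in cyclic order; tuples that agree up to rotation or reflection denote the same configuration, and $()$ denotes the empty (terminal) configuration. A P-position is a configuration from which the player to move loses under optimal play by the opponent. -}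

module Defs where

open import Data.Nat using (ℕ; zero; suc; _≤_; _<_)
open import Data.List using (List; []; _∷_; _++_; take; drop; length)
open import Data.Nat.ListAction using (sum)
open import Data.List.Relation.Binary.Pointwise using (Pointwise)
open import Data.Product using (Σ; _×_)

-- A configuration is a list of (positive) pile sizes in cyclic order.

rotate : ℕ → List ℕ → List ℕ
rotate i xs = drop i xs ++ take i xs

-- Empty piles vanish and the circle closes up.
removeZeros : List ℕ → List ℕ
removeZeros [] = []
removeZeros (zero ∷ xs) = removeZeros xs
removeZeros (suc n ∷ xs) = suc n ∷ removeZeros xs

-- A move of Shrinking Circular Nim with parameter k:
-- rotate so that the chosen block of k consecutive piles comes first
-- (if at most k piles remain, take k selects all of them), replace the
-- selected piles by smaller-or-equal sizes zs, removing at least one stone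
-- in total, and then delete the empty piles.
data Move (k : ℕ) (xs : List ℕ) : List ℕ → Set where
  move : (i : ℕ) → i < length xs → (zs : List ℕ)
       → Pointwise _≤_ zs (take k (rotate i xs))
       → sum zs < sum (take k (rotate i xs))
       → Move k xs (removeZeros (zs ++ drop k (rotate i xs)))

-- Outcome classes (normal play; the game is finite since every move removes a stone).
mutual
  data Lose (k : ℕ) (xs : List ℕ) : Set where
    lose : (∀ ys → Move k xs ys → Win k ys) → Lose k xs

  data Win (k : ℕ) (xs : List ℕ) : Set where
    win : (ys : List ℕ) → Move k xs ys → Lose k ys → Win k xs

-- P-position of SCN(n,k) (n only constrains which configurations arise).
IsPPosition : ℕ → List ℕ → Set
IsPPosition k xs = Lose k xs

{-# OPTIONS --safe #-}
-- The listed configurations form a kernel of the move graph of SCN(4,2). No move leads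
-- from one to another: lowering two adjacent piles of (a,a,a) or (a,b,a,b) never restores
-- the pattern. Every other configuration of at most four piles moves into one: with three
-- piles, lower the two piles in front of a smallest pile to its size; with four piles,
-- rotate to (p,q,r,s) with r ≤ p and s ≤ q and lower (p,q) to (r,s), or empty p when
-- r = s. Since every move removes a stone, induction on the number of stones shows that
-- a kernel consists exactly of the P-positions.
module Submission where

open import Defs
open import Data.Nat using (ℕ; zero; suc; _+_; _≤_; _<_; z≤n; s≤s; _≤?_; _≟_)
open import Data.Nat.Properties
open import Data.Nat.Induction using (<-wellFounded)
open import Data.Nat.ListAction using (sum)
open import Data.Nat.ListAction.Properties using (sum-++; sum-↭)
open import Data.List using (List; []; _∷_; _++_; take; drop; length)
open import Data.List.Properties using (length-++; take++drop≡id; ≡-dec)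
open import Data.List.Relation.Binary.Pointwise using (Pointwise; Pointwise-length; []; _∷_)
open import Data.List.Relation.Binary.Permutation.Propositional using (_↭_; ↭-trans; ↭-reflexive)
open import Data.List.Relation.Binary.Permutation.Propositional.Properties using (++-comm; ↭-length)
open import Data.List.Relation.Unary.All using (All; []; _∷_)
open import Data.Product using (Σ; _×_; _,_)
open import Data.Sum using (_⊎_; inj₁; inj₂)
open import Data.Empty using (⊥-elim)
open import Function using (_∘_; id)
open import Function.Bundles using (_⇔_; mk⇔)
open import Function.Construct.Composition using (_⇔-∘_)
open import Induction.WellFounded using (Acc; acc)
open import Relation.Nullary using (¬_; yes; no)
open import Relation.Binary.PropositionalEquality using (_≡_; _≢_; refl; cong; ≢-sym)

sum-mono-≤ : ∀ {ms ns} → Pointwise _≤_ ms ns → sum ms ≤ sum ns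
sum-mono-≤ []            = z≤n
sum-mono-≤ (m≤n ∷ ms≤ns) = +-mono-≤ m≤n (sum-mono-≤ ms≤ns)

sum-mono-< : ∀ {ms ns} → Pointwise _≤_ ms ns → ms ≢ ns → sum ms < sum ns
sum-mono-< [] []≢[] = ⊥-elim ([]≢[] refl)
sum-mono-< {m ∷ _} {n ∷ _} (m≤n ∷ ms≤ns) m∷ms≢n∷ns with m ≟ n
... | yes refl = +-monoʳ-< m (sum-mono-< ms≤ns (m∷ms≢n∷ns ∘ cong (m ∷_)))
... | no m≢n   = +-mono-<-≤ (≤∧≢⇒< m≤n m≢n) (sum-mono-≤ ms≤ns)

rotate-↭ : ∀ i (xs : List ℕ) → rotate i xs ↭ xs
rotate-↭ i xs = ↭-trans (++-comm (drop i xs) (take i xs)) (↭-reflexive (take++drop≡id i xs))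

removeZeros-positive : ∀ xs → All (1 ≤_) (removeZeros xs)
removeZeros-positive []           = []
removeZeros-positive (zero ∷ xs)  = removeZeros-positive xs
removeZeros-positive (suc _ ∷ xs) = s≤s z≤n ∷ removeZeros-positive xs

length-removeZeros : ∀ xs → length (removeZeros xs) ≤ length xs
length-removeZeros []           = z≤n
length-removeZeros (zero ∷ xs)  = m≤n⇒m≤1+n (length-removeZeros xs)
length-removeZeros (suc _ ∷ xs) = s≤s (length-removeZeros xs)

sum-removeZeros : ∀ xs → sum (removeZeros xs) ≡ sum xs
sum-removeZeros []           = refl
sum-removeZeros (zero ∷ xs)  = sum-removeZeros xs
sum-removeZeros (suc n ∷ xs) = cong (suc n +_) (sum-removeZeros xs)

module _ {k : ℕ} {xs : List ℕ} where

  Move-positive : ∀ {ys} → Move k xs ys → All (1 ≤_) ys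
  Move-positive (move i _ zs _ _) = removeZeros-positive (zs ++ drop k (rotate i xs))

  Move-length : ∀ {ys} → Move k xs ys → length ys ≤ length xs
  Move-length (move i _ zs zs≤ _) = begin
    length (removeZeros (zs ++ D))  ≤⟨ length-removeZeros (zs ++ D) ⟩
    length (zs ++ D)                ≡⟨ length-++ zs ⟩
    length zs + length D            ≡⟨ cong (_+ length D) (Pointwise-length zs≤) ⟩
    length (take k R) + length D    ≡⟨ length-++ (take k R) ⟨
    length (take k R ++ D)          ≡⟨ cong length (take++drop≡id k R) ⟩
    length R                        ≡⟨ ↭-length (rotate-↭ i xs) ⟩
    length xs                       ∎
    where
    open ≤-Reasoning
    R = rotate i xs
    D = drop k R

  Move-sum : ∀ {ys} → Move k xs ys → sum ys < sum xs
  Move-sum (move i _ zs _ zs<) = begin-strict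
    sum (removeZeros (zs ++ D))  ≡⟨ sum-removeZeros (zs ++ D) ⟩
    sum (zs ++ D)                ≡⟨ sum-++ zs D ⟩
    sum zs + sum D               <⟨ +-monoˡ-< (sum D) zs< ⟩
    sum (take k R) + sum D       ≡⟨ sum-++ (take k R) D ⟨
    sum (take k R ++ D)          ≡⟨ cong sum (take++drop≡id k R) ⟩
    sum R                        ≡⟨ sum-↭ (rotate-↭ i xs) ⟩
    sum xs                       ∎
    where
    open ≤-Reasoning
    R = rotate i xs
    D = drop k R

Lose⇒¬Win : ∀ {k xs} → Lose k xs → ¬ Win k xs
Lose⇒¬Win (lose reply) (win ys xs→ys ys-lost) = Lose⇒¬Win ys-lost (reply ys xs→ys)

module Kernel
  (k : ℕ) (Valid P : List ℕ → Set)
  (Move-Valid : ∀ {xs ys} → Valid xs → Move k xs ys → Valid ys)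
  (P-stable : ∀ {xs ys} → P xs → Move k xs ys → ¬ P ys)
  (P-absorbing : ∀ {xs} → Valid xs → P xs ⊎ Σ (List ℕ) (λ ys → Move k xs ys × P ys))
  where

  P⇒Lose : ∀ {xs} → Acc _<_ (sum xs) → Valid xs → P xs → Lose k xs
  P⇒Lose {xs} (acc smaller) valid p = lose reply
    where
    reply : ∀ ys → Move k xs ys → Win k ys
    reply ys xs→ys with P-absorbing (Move-Valid valid xs→ys)
    ... | inj₁ p-ys = ⊥-elim (P-stable p xs→ys p-ys)
    ... | inj₂ (zs , ys→zs , p-zs) = win zs ys→zs
      (P⇒Lose (smaller (<-trans (Move-sum ys→zs) (Move-sum xs→ys)))
              (Move-Valid (Move-Valid valid xs→ys) ys→zs) p-zs)

  Lose⇔P : ∀ {xs} → Valid xs → Lose k xs ⇔ P xs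
  Lose⇔P {xs} valid = mk⇔ Lose⇒P (P⇒Lose (<-wellFounded _) valid)
    where
    Lose⇒P : Lose k xs → P xs
    Lose⇒P (lose reply) with P-absorbing valid
    ... | inj₁ p = p
    ... | inj₂ (ys , xs→ys , p-ys) = ⊥-elim
      (Lose⇒¬Win (P⇒Lose (<-wellFounded _) (Move-Valid valid xs→ys) p-ys) (reply ys xs→ys))

Config : List ℕ → Set
Config xs = All (1 ≤_) xs × length xs ≤ 4

Move-Config : ∀ {k xs ys} → Config xs → Move k xs ys → Config ys
Move-Config (_ , length≤4) xs→ys = Move-positive xs→ys , ≤-trans (Move-length xs→ys) length≤4

-- The configurations of the theorem as an inductive family, so that lists of any other
-- shape are refuted by absurd patterns.
data PShape : List ℕ → Set where
  empty       : PShape []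
  triple      : ∀ {a} → 1 ≤ a → PShape (a ∷ a ∷ a ∷ [])
  alternating : ∀ {a b} → 1 ≤ a → 1 ≤ b → a ≢ b → PShape (a ∷ b ∷ a ∷ b ∷ [])

Listed : List ℕ → Set
Listed xs = xs ≡ []
  ⊎ Σ ℕ (λ a → 1 ≤ a × xs ≡ a ∷ a ∷ a ∷ [])
  ⊎ Σ ℕ (λ a → Σ ℕ (λ b → 1 ≤ a × 1 ≤ b × a ≢ b × xs ≡ a ∷ b ∷ a ∷ b ∷ []))

PShape⇔Listed : ∀ {xs} → PShape xs ⇔ Listed xs
PShape⇔Listed = mk⇔ to from
  where
  to : ∀ {xs} → PShape xs → Listed xs
  to empty                     = inj₁ refl
  to (triple 1≤a)              = inj₂ (inj₁ (_ , 1≤a , refl))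
  to (alternating 1≤a 1≤b a≢b) = inj₂ (inj₂ (_ , _ , 1≤a , 1≤b , a≢b , refl))
  from : ∀ {xs} → Listed xs → PShape xs
  from (inj₁ refl)                                    = empty
  from (inj₂ (inj₁ (_ , 1≤a , refl)))                 = triple 1≤a
  from (inj₂ (inj₂ (_ , _ , 1≤a , 1≤b , a≢b , refl))) = alternating 1≤a 1≤b a≢b

lowered-triple-¬PShape : ∀ {a zs} → Pointwise _≤_ zs (suc a ∷ suc a ∷ []) →
  sum zs < sum (suc a ∷ suc a ∷ []) → ¬ PShape (removeZeros (zs ++ suc a ∷ []))
lowered-triple-¬PShape (_∷_ {x = zero}  _ (_∷_ {x = zero}  _ [])) _  ()
lowered-triple-¬PShape (_∷_ {x = zero}  _ (_∷_ {x = suc _} _ [])) _  ()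
lowered-triple-¬PShape (_∷_ {x = suc _} _ (_∷_ {x = zero}  _ [])) _  ()
lowered-triple-¬PShape (_∷_ {x = suc _} _ (_∷_ {x = suc _} _ [])) z< (triple _) = <-irrefl refl z<

lowered-alternating-¬PShape : ∀ {a b zs} → suc a ≢ suc b → Pointwise _≤_ zs (suc a ∷ suc b ∷ []) →
  sum zs < sum (suc a ∷ suc b ∷ []) → ¬ PShape (removeZeros (zs ++ suc a ∷ suc b ∷ []))
lowered-alternating-¬PShape _   (_∷_ {x = zero}  _ (_∷_ {x = zero}  _ [])) _  ()
lowered-alternating-¬PShape a≢b (_∷_ {x = zero}  _ (_∷_ {x = suc _} _ [])) _  (triple _) = a≢b refl
lowered-alternating-¬PShape a≢b (_∷_ {x = suc _} _ (_∷_ {x = zero}  _ [])) _  (triple _) = a≢b refl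
lowered-alternating-¬PShape _   (_∷_ {x = suc _} _ (_∷_ {x = suc _} _ [])) z< (alternating _ _ _) =
  <-irrefl refl z<

PShape-stable : ∀ {xs ys} → PShape xs → Move 2 xs ys → ¬ PShape ys
PShape-stable empty (move _ () _ _ _)
PShape-stable (triple (s≤s z≤n)) (move 0 _ _ zs≤ z<) = lowered-triple-¬PShape zs≤ z<
PShape-stable (triple (s≤s z≤n)) (move 1 _ _ zs≤ z<) = lowered-triple-¬PShape zs≤ z<
PShape-stable (triple (s≤s z≤n)) (move 2 _ _ zs≤ z<) = lowered-triple-¬PShape zs≤ z<
PShape-stable (triple _) (move (suc (suc (suc _))) (s≤s (s≤s (s≤s ()))) _ _ _)
PShape-stable (alternating (s≤s z≤n) (s≤s z≤n) a≢b) (move 0 _ _ zs≤ z<) =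
  lowered-alternating-¬PShape a≢b zs≤ z<
PShape-stable (alternating (s≤s z≤n) (s≤s z≤n) a≢b) (move 1 _ _ zs≤ z<) =
  lowered-alternating-¬PShape (≢-sym a≢b) zs≤ z<
PShape-stable (alternating (s≤s z≤n) (s≤s z≤n) a≢b) (move 2 _ _ zs≤ z<) =
  lowered-alternating-¬PShape a≢b zs≤ z<
PShape-stable (alternating (s≤s z≤n) (s≤s z≤n) a≢b) (move 3 _ _ zs≤ z<) =
  lowered-alternating-¬PShape (≢-sym a≢b) zs≤ z<
PShape-stable (alternating _ _ _) (move (suc (suc (suc (suc _)))) (s≤s (s≤s (s≤s (s≤s ())))) _ _ _)

Reaches : List ℕ → Set
Reaches xs = Σ (List ℕ) λ ys → Move 2 xs ys × PShape ys

FrontLowering : List ℕ → Set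
FrontLowering R = Σ (List ℕ) λ zs →
  Pointwise _≤_ zs (take 2 R) × zs ≢ take 2 R × PShape (removeZeros (zs ++ drop 2 R))

reach-by-rotation : ∀ {xs} i → i < length xs → (PShape (rotate i xs) → PShape xs) →
  PShape (rotate i xs) ⊎ FrontLowering (rotate i xs) → PShape xs ⊎ Reaches xs
reach-by-rotation _ _   unrotate (inj₁ p)                  = inj₁ (unrotate p)
reach-by-rotation i i<n _        (inj₂ (zs , zs≤ , zs≢ , p)) =
  inj₂ (_ , move i i<n zs zs≤ (sum-mono-< zs≤ zs≢) , p)

PShape-unrotate₃ : ∀ i {a b c} → PShape (rotate i (a ∷ b ∷ c ∷ [])) → PShape (a ∷ b ∷ c ∷ [])
PShape-unrotate₃ 0                         p          = p
PShape-unrotate₃ 1                         (triple p) = triple p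
PShape-unrotate₃ 2                         (triple p) = triple p
PShape-unrotate₃ 3                         p          = p
PShape-unrotate₃ (suc (suc (suc (suc _)))) p          = p

PShape-unrotate₄ : ∀ i {a b c d} → PShape (rotate i (a ∷ b ∷ c ∷ d ∷ [])) → PShape (a ∷ b ∷ c ∷ d ∷ [])
PShape-unrotate₄ 0                               p                           = p
PShape-unrotate₄ 1                               (alternating 1≤b 1≤a b≢a) = alternating 1≤a 1≤b (≢-sym b≢a)
PShape-unrotate₄ 2                               (alternating 1≤a 1≤b a≢b) = alternating 1≤a 1≤b a≢b
PShape-unrotate₄ 3                               (alternating 1≤b 1≤a b≢a) = alternating 1≤a 1≤b (≢-sym b≢a)
PShape-unrotate₄ 4                               p                           = p
PShape-unrotate₄ (suc (suc (suc (suc (suc _))))) p                           = p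

lower-to-triple : ∀ {x y m} → 1 ≤ m → m ≤ x → m ≤ y →
  PShape (x ∷ y ∷ m ∷ []) ⊎ FrontLowering (x ∷ y ∷ m ∷ [])
lower-to-triple {x} {y} {suc m} 1≤m m≤x m≤y with ≡-dec _≟_ (suc m ∷ suc m ∷ []) (x ∷ y ∷ [])
... | yes refl = inj₁ (triple 1≤m)
... | no m∷m≢x∷y = inj₂ (_ , (m≤x ∷ m≤y ∷ []) , m∷m≢x∷y , triple 1≤m)

lower-to-alternating : ∀ {p q r s} → 1 ≤ p → 1 ≤ r → 1 ≤ s → r ≤ p → s ≤ q →
  PShape (p ∷ q ∷ r ∷ s ∷ []) ⊎ FrontLowering (p ∷ q ∷ r ∷ s ∷ [])
lower-to-alternating {suc p} {q} {suc r} {suc s} _ 1≤r 1≤s r≤p s≤q with r ≟ s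
... | yes refl = inj₂ ((0 ∷ suc r ∷ []) , (z≤n ∷ s≤q ∷ []) , (λ ()) , triple 1≤r)
... | no r≢s with ≡-dec _≟_ (suc r ∷ suc s ∷ []) (suc p ∷ q ∷ [])
...   | yes refl    = inj₁ (alternating 1≤r 1≤s (r≢s ∘ suc-injective))
...   | no r∷s≢p∷q = inj₂ (_ , (r≤p ∷ s≤q ∷ []) , r∷s≢p∷q , alternating 1≤r 1≤s (r≢s ∘ suc-injective))

three-piles-absorbing : ∀ {a b c} → 1 ≤ a → 1 ≤ b → 1 ≤ c →
  PShape (a ∷ b ∷ c ∷ []) ⊎ Reaches (a ∷ b ∷ c ∷ [])
three-piles-absorbing {a} {b} {c} 1≤a 1≤b 1≤c with c ≤? a | c ≤? b
... | yes c≤a | yes c≤b =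
  reach-by-rotation 0 (s≤s z≤n) id (lower-to-triple 1≤c c≤a c≤b)
... | yes c≤a | no c≰b =
  reach-by-rotation 2 (s≤s (s≤s (s≤s z≤n))) (PShape-unrotate₃ 2)
    (lower-to-triple 1≤b (≰⇒≥ c≰b) (≤-trans (≰⇒≥ c≰b) c≤a))
... | no c≰a | _ with a ≤? b
...   | yes a≤b =
  reach-by-rotation 1 (s≤s (s≤s z≤n)) (PShape-unrotate₃ 1) (lower-to-triple 1≤a a≤b (≰⇒≥ c≰a))
...   | no a≰b =
  reach-by-rotation 2 (s≤s (s≤s (s≤s z≤n))) (PShape-unrotate₃ 2)
    (lower-to-triple 1≤b (≤-trans (≰⇒≥ a≰b) (≰⇒≥ c≰a)) (≰⇒≥ a≰b))

four-piles-absorbing : ∀ {a b c d} → 1 ≤ a → 1 ≤ b → 1 ≤ c → 1 ≤ d →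
  PShape (a ∷ b ∷ c ∷ d ∷ []) ⊎ Reaches (a ∷ b ∷ c ∷ d ∷ [])
four-piles-absorbing {a} {b} {c} {d} 1≤a 1≤b 1≤c 1≤d with c ≤? a | d ≤? b
... | yes c≤a | yes d≤b =
  reach-by-rotation 0 (s≤s z≤n) id (lower-to-alternating 1≤a 1≤c 1≤d c≤a d≤b)
... | no c≰a | yes d≤b =
  reach-by-rotation 1 (s≤s (s≤s z≤n)) (PShape-unrotate₄ 1)
    (lower-to-alternating 1≤b 1≤d 1≤a d≤b (≰⇒≥ c≰a))
... | no c≰a | no d≰b =
  reach-by-rotation 2 (s≤s (s≤s (s≤s z≤n))) (PShape-unrotate₄ 2)
    (lower-to-alternating 1≤c 1≤a 1≤b (≰⇒≥ c≰a) (≰⇒≥ d≰b))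
... | yes c≤a | no d≰b =
  reach-by-rotation 3 (s≤s (s≤s (s≤s (s≤s z≤n)))) (PShape-unrotate₄ 3)
    (lower-to-alternating 1≤d 1≤b 1≤c (≰⇒≥ d≰b) c≤a)

PShape-absorbing : ∀ {xs} → Config xs → PShape xs ⊎ Reaches xs
PShape-absorbing {[]} _ = inj₁ empty
PShape-absorbing {suc _ ∷ []} _ =
  inj₂ (_ , move 0 (s≤s z≤n) (0 ∷ []) (z≤n ∷ []) (s≤s z≤n) , empty)
PShape-absorbing {suc _ ∷ _ ∷ []} _ =
  inj₂ (_ , move 0 (s≤s z≤n) (0 ∷ 0 ∷ []) (z≤n ∷ z≤n ∷ []) (s≤s z≤n) , empty)
PShape-absorbing {zero ∷ _} (() ∷ _ , _)
PShape-absorbing {_ ∷ _ ∷ _ ∷ []} (1≤a ∷ 1≤b ∷ 1≤c ∷ [] , _) = three-piles-absorbing 1≤a 1≤b 1≤c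
PShape-absorbing {_ ∷ _ ∷ _ ∷ _ ∷ []} (1≤a ∷ 1≤b ∷ 1≤c ∷ 1≤d ∷ [] , _) =
  four-piles-absorbing 1≤a 1≤b 1≤c 1≤d
PShape-absorbing {_ ∷ _ ∷ _ ∷ _ ∷ _ ∷ _} (_ , s≤s (s≤s (s≤s (s≤s ()))))

open Kernel 2 Config PShape Move-Config PShape-stable PShape-absorbing

theorem2p3 : (xs : List ℕ) → All (1 ≤_) xs → length xs ≤ 4 →
    (IsPPosition 2 xs ⇔
      (xs ≡ []
       ⊎ Σ ℕ (λ a → 1 ≤ a × xs ≡ a ∷ a ∷ a ∷ [])
       ⊎ Σ ℕ (λ a → Σ ℕ (λ b → 1 ≤ a × 1 ≤ b × a ≢ b × xs ≡ a ∷ b ∷ a ∷ b ∷ []))))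
theorem2p3 xs positive length≤4 = PShape⇔Listed ⇔-∘ Lose⇔P (positive , length≤4)
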